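{- Let $M\in\{M_1,\ldots,M_{13}\}$ and let $h$ be a positive integer such that $\sigma(M^{2h})$ factors in $\mathcal{F}$. Then ($M=M_1$ and $h\in\{1,2,3,7\}$) or ($M\in\{M_2,M_3\}$ and $h=1$). Moreover $\sigma(M_2^2)=M_1M_5$, $\sigma(M_3^2)=M_1M_4$, $\sigma(M_1^2)=S_1$, $\sigma(M_1^4)=S_8$, $\sigma(M_1^6)=M_2M_3S_2$ and $\sigma(M_1^{14})=M_4M_5S_1S_7S_8$.
   Context: All polynomials are in $\mathbb{F}_2[x]$; $\sigma(A)$ is the sum of all divisors of $A$, so for irreducible $M$, $\sigma(M^{2h})=1+M+\cdots+M^{2h}$. A polynomial factors in $\mathcal{F}$ if all its irreducible factors belong to $\mathcal{F}$. $\overline{T}(x):=T(x+1)$; for $Q$ and positive integers $a,b,c$, $Q^{abc}:=1+x^a(x+1)^bQ^c$. $\mathcal{F}=\{M_1,\ldots,M_{13},S_1,\ldots,S_{15}\}$ where $M_1=1+x+x^2$, $M_2=1+x+x^3$, $M_3=1+x^2+x^3$, $M_4=1+x+x^2+x^3+x^4$, $M_5=1+x^3+x^4$, $M_6=1+x^3+x^5$, $M_7=1+x^3+x^7$, $M_8=1+x^6+x^7$, $M_9=\overline{M_6}$, $M_{10}=\overline{M_7}$, $M_{11}=\overline{M_8}$, $M_{12}=x^9+x+1$, $M_{13}=x^9+x^8+1$; $S_1=M_1^{111}$, $S_2=M_1^{221}$, $S_3=M_1^{134}$, $S_4=M_1^{311}$, $S_5=M_1^{131}$, $S_6=M_1^{314}$,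 $S_7=M_1^{113}$, $S_8=M_1^{331}$, $S_9=M_1^{115}$, $S_{10}=M_1^{411}$, $S_{11}=M_1^{121}$, $S_{12}=M_1^{212}$, $S_{13}=M_1^{141}$, $S_{14}=M_1^{211}$, $S_{15}=M_1^{122}$. -}

module Defs where

open import Data.Bool using (Bool; true; false; _xor_; if_then_else_)
open import Data.List using (List; []; _∷_; length)
open import Data.List.Relation.Unary.Any using (Any)
open import Data.Nat using (ℕ; zero; suc; _≡ᵇ_)
open import Data.Product using (Σ; _×_)
open import Data.Sum using (_⊎_)
open import Relation.Binary.PropositionalEquality using (_≡_)

-- Polynomials in F₂[x], as coefficient lists, lowest degree first:
-- (a₀ ∷ a₁ ∷ … ∷ aₙ ∷ []) stands for a₀ + a₁ x + … + aₙ xⁿ.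
-- Trailing zero coefficients are allowed; equality of polynomials is
-- `_≈_` (equality after stripping trailing zeros).

Poly : Set
Poly = List Bool

norm : Poly → Poly
norm [] = []
norm (a ∷ p) with norm p
... | [] = if a then true ∷ [] else []
... | q@(_ ∷ _) = a ∷ q

infix 4 _≈_
_≈_ : Poly → Poly → Set
p ≈ q = norm p ≡ norm q

-- number of coefficients after normalisation (= degree + 1 for p ≠ 0,
-- and 0 for the zero polynomial)
size : Poly → ℕ
size p = length (norm p)

infixl 6 _+_
infixl 7 _*_

_+_ : Poly → Poly → Poly
[] + q = q
(a ∷ p) + [] = a ∷ p
(a ∷ p) + (b ∷ q) = (a xor b) ∷ (p + q)

_*_ : Poly → Poly → Poly
[] * q = []
(a ∷ p) * q = (if a then q else []) + (false ∷ (p * q))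

one : Poly
one = true ∷ []

X : Poly
X = false ∷ true ∷ []

X+1 : Poly
X+1 = true ∷ true ∷ []

_^_ : Poly → ℕ → Poly
p ^ zero = one
p ^ suc n = p * (p ^ n)

-- T̄(x) := T(x+1)  (Horner evaluation at x+1)
bar : Poly → Poly
bar [] = []
bar (a ∷ p) = (a ∷ []) + X+1 * bar p

Qabc : Poly → ℕ → ℕ → ℕ → Poly
Qabc Q a b c = one + (X ^ a) * (X+1 ^ b) * (Q ^ c)

-- σ(M^n) for irreducible M: 1 + M + M² + … + Mⁿ
sigmaPow : Poly → ℕ → Poly
sigmaPow M zero = one
sigmaPow M (suc n) = sigmaPow M n + M ^ suc n

infix 4 _∣_
_∣_ : Poly → Poly → Set
B ∣ A = Σ Poly λ C → C * B ≈ A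

Irreducible : Poly → Set
Irreducible P = (2 Data.Nat.≤ size P)
              × (∀ A B → A * B ≈ P → size A ≡ 1 ⊎ size B ≡ 1)

FactorsIn : List Poly → Poly → Set
FactorsIn F A = ∀ P → Irreducible P → P ∣ A → Any (P ≈_) F

M1 M2 M3 M4 M5 M6 M7 M8 M9 M10 M11 M12 M13 : Poly
M1 = true ∷ true ∷ true ∷ []
M2 = true ∷ true ∷ false ∷ true ∷ []
M3 = true ∷ false ∷ true ∷ true ∷ []
M4 = true ∷ true ∷ true ∷ true ∷ true ∷ []
M5 = true ∷ false ∷ false ∷ true ∷ true ∷ []
M6 = true ∷ false ∷ false ∷ true ∷ false ∷ true ∷ []
M7 = true ∷ false ∷ false ∷ true ∷ false ∷ false ∷ false ∷ true ∷ []
M8 = true ∷ false ∷ false ∷ false ∷ false ∷ false ∷ true ∷ true ∷ []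
M9 = bar M6
M10 = bar M7
M11 = bar M8
M12 = true ∷ true ∷ false ∷ false ∷ false ∷ false ∷ false ∷ false ∷ false ∷ true ∷ []
M13 = true ∷ false ∷ false ∷ false ∷ false ∷ false ∷ false ∷ false ∷ true ∷ true ∷ []

S1 S2 S3 S4 S5 S6 S7 S8 S9 S10 S11 S12 S13 S14 S15 : Poly
S1 = Qabc M1 1 1 1
S2 = Qabc M1 2 2 1
S3 = Qabc M1 1 3 4
S4 = Qabc M1 3 1 1
S5 = Qabc M1 1 3 1
S6 = Qabc M1 3 1 4
S7 = Qabc M1 1 1 3
S8 = Qabc M1 3 3 1
S9 = Qabc M1 1 1 5
S10 = Qabc M1 4 1 1
S11 = Qabc M1 1 2 1
S12 = Qabc M1 2 1 2
S13 = Qabc M1 1 4 1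
S14 = Qabc M1 2 1 1
S15 = Qabc M1 1 2 2

Mlist : List Poly
Mlist = M1 ∷ M2 ∷ M3 ∷ M4 ∷ M5 ∷ M6 ∷ M7 ∷ M8 ∷ M9 ∷ M10 ∷ M11 ∷ M12 ∷ M13 ∷ []

Fam : List Poly
Fam = M1 ∷ M2 ∷ M3 ∷ M4 ∷ M5 ∷ M6 ∷ M7 ∷ M8 ∷ M9 ∷ M10 ∷ M11 ∷ M12 ∷ M13
    ∷ S1 ∷ S2 ∷ S3 ∷ S4 ∷ S5 ∷ S6 ∷ S7 ∷ S8 ∷ S9 ∷ S10 ∷ S11 ∷ S12 ∷ S13 ∷ S14 ∷ S15 ∷ []

-- If an irreducible Q divides σ(M^{p-1}) for an odd prime p, then M^p ≡ 1 (mod Q), since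
-- (M + 1)σ(M^{p-1}) = M^p + 1, while M ≡ 1 would give σ(M^{p-1}) ≡ p ≡ 1.  For each member Q
-- of 𝓕 a computation shows M ≡ 0 or M^{2^{deg Q}-1} ≡ 1 (mod Q), so p must divide one of the
-- Mersenne numbers 2^d - 1 with d a degree occurring in 𝓕: only eight primes remain.  As
-- (a+1) | (n+1) makes σ(M^a) divide σ(M^n), every divisor m of 2h+1 needs σ(M^{m-1}) to factor
-- in 𝓕; dividing the members of 𝓕 out of σ(M^{m-1}) and finding a nonconstant remainder excludes
-- all products of admissible primes except the listed ones.

module Submission where

open import Algebra.Bundles using (CommutativeSemigroup)
open import Data.Bool using (Bool; true; false; _xor_; if_then_else_)
import Data.Bool as Bool
open import Data.Bool.Properties using (xor-assoc; xor-comm; xor-same; xor-identityʳ)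
open import Data.Empty using (⊥; ⊥-elim)
open import Data.List using (List; []; _∷_; length; map; _++_)
open import Data.List.Membership.Propositional using (_∈_; _∉_; lose)
open import Data.List.Membership.Propositional.Properties using (∈-map⁺; ∈-++⁺ˡ; ∈-++⁺ʳ)
open import Data.List.Properties using (≡-dec)
open import Data.List.Relation.Unary.All as All using (All; all?; lookupAny)
open import Data.List.Relation.Unary.All.Properties using (All¬⇒¬Any)
open import Data.List.Relation.Unary.Any as Any using (Any; here; there; any?; satisfied)
open import Data.Maybe using (Maybe; just; nothing; _>>=_)
open import Data.Nat using (ℕ; zero; suc; _≤_; _<_; z≤n; s≤s; _≤?_; _<?_; _∸_)
import Data.Nat as ℕ
import Data.Nat.Properties as ℕ
open import Data.List.Membership.DecPropositional ℕ._≟_ using (_∈?_)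
open import Data.Nat.Coprimality using (Coprime; coprime-Bézout)
open import Data.Nat.Divisibility using (divides; ∣-trans; ∣-refl; m∣m*n; n∣m*n; 0∣⇒≡0)
  renaming (_∣_ to _∣ℕ_)
open import Data.Nat.GCD using (module Bézout)
open import Data.Nat.ListAction using (product)
open import Data.Nat.Primality using (Prime; prime?; prime⇒irreducible; ¬prime[1])
open import Data.Nat.Primality.Factorisation
  using (factorise; PrimeFactorisation; factorisationHasAllPrimeFactors)
open PrimeFactorisation using (factors; isFactorisation; factorsPrime)
open import Data.Nat.Tactic.RingSolver using (solve)
open import Data.Product using (Σ; _×_; _,_; proj₁; proj₂)
open import Data.Sum using (_⊎_; inj₁; inj₂)
open import Function using (_∘_)
open import Relation.Binary.Bundles using (Setoid)
open import Relation.Binary.Structures using (IsEquivalence)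
open import Relation.Binary.PropositionalEquality
  using (_≡_; _≢_; refl; sym; trans; cong; cong₂; subst; subst₂; module ≡-Reasoning)
import Relation.Binary.Reasoning.Setoid as ≈-Reasoning
open import Relation.Nullary using (¬_; Dec; yes; no)
open import Relation.Nullary.Decidable using (_×-dec_; _⊎-dec_; map′; from-yes)

open import Defs

coeff : Poly → ℕ → Bool
coeff []      i       = false
coeff (a ∷ p) zero    = a
coeff (a ∷ p) (suc i) = coeff p i

cons : Bool → Poly → Poly
cons a []          = if a then true ∷ [] else []
cons a q@(_ ∷ _)   = a ∷ q

norm-∷ : ∀ a p → norm (a ∷ p) ≡ cons a (norm p)
norm-∷ a p with norm p
... | []    = refl
... | _ ∷ _ = refl

coeff-cons : ∀ a q i → coeff (cons a q) i ≡ coeff (a ∷ q) i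
coeff-cons true  []      zero    = refl
coeff-cons false []      zero    = refl
coeff-cons true  []      (suc i) = refl
coeff-cons false []      (suc i) = refl
coeff-cons a     (_ ∷ _) i       = refl

coeff-norm : ∀ p i → coeff (norm p) i ≡ coeff p i
coeff-norm []      i       = refl
coeff-norm (a ∷ p) i rewrite norm-∷ a p = trans (coeff-cons a (norm p) i) (tail i)
  where
  tail : ∀ i → coeff (a ∷ norm p) i ≡ coeff (a ∷ p) i
  tail zero    = refl
  tail (suc i) = coeff-norm p i

-- `p ≈ q` unfolds to an equation between normal forms, from which Agda
-- cannot recover p and q; the record makes them inferable.
infix 4 _≋_
record _≋_ (p q : Poly) : Set where
  constructor ≈⇒≋
  field ≋⇒≈ : p ≈ q
open _≋_ public

≈-ext : ∀ p q → (∀ i → coeff p i ≡ coeff q i) → p ≈ q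
≈-ext []      []      c = refl
≈-ext []      (b ∷ q) c rewrite norm-∷ b q | sym (c 0) | sym (≈-ext [] q (λ i → c (suc i))) = refl
≈-ext (a ∷ p) []      c rewrite norm-∷ a p | c 0 | ≈-ext p [] (λ i → c (suc i)) = refl
≈-ext (a ∷ p) (b ∷ q) c rewrite norm-∷ a p | norm-∷ b q | c 0 | ≈-ext p q (λ i → c (suc i)) = refl

≋-ext : ∀ {p q} → (∀ i → coeff p i ≡ coeff q i) → p ≋ q
≋-ext {p} {q} c = ≈⇒≋ (≈-ext p q c)

≋-coeff : ∀ {p q} → p ≋ q → ∀ i → coeff p i ≡ coeff q i
≋-coeff {p} {q} (≈⇒≋ e) i = trans (sym (coeff-norm p i)) (trans (cong (λ r → coeff r i) e) (coeff-norm q i))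

norm-idem : ∀ p → norm (norm p) ≡ norm p
norm-idem p = ≈-ext (norm p) p (coeff-norm p)

infix 4 _≋?_
_≋?_ : ∀ p q → Dec (p ≋ q)
p ≋? q = map′ ≈⇒≋ ≋⇒≈ (≡-dec Bool._≟_ (norm p) (norm q))

≋-isEquivalence : IsEquivalence _≋_
≋-isEquivalence = record
  { refl  = ≈⇒≋ refl
  ; sym   = λ (≈⇒≋ e) → ≈⇒≋ (sym e)
  ; trans = λ (≈⇒≋ e) (≈⇒≋ f) → ≈⇒≋ (trans e f)
  }

≋-setoid : Setoid _ _
≋-setoid = record { isEquivalence = ≋-isEquivalence }

open IsEquivalence ≋-isEquivalence public
  using () renaming (refl to ≋-refl; sym to ≋-sym; trans to ≋-trans; reflexive to ≋-reflexive)

-- Ring structure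

coeff-+ : ∀ p q i → coeff (p + q) i ≡ coeff p i xor coeff q i
coeff-+ []      q       i       = refl
coeff-+ (a ∷ p) []      i       = sym (xor-identityʳ _)
coeff-+ (a ∷ p) (b ∷ q) zero    = refl
coeff-+ (a ∷ p) (b ∷ q) (suc i) = coeff-+ p q i

+-cong : ∀ {p p′ q q′} → p ≋ p′ → q ≋ q′ → p + q ≋ p′ + q′
+-cong {p} {p′} {q} {q′} e f = ≋-ext λ i → begin
  coeff (p + q) i             ≡⟨ coeff-+ p q i ⟩
  coeff p i xor coeff q i     ≡⟨ cong₂ _xor_ (≋-coeff e i) (≋-coeff f i) ⟩
  coeff p′ i xor coeff q′ i   ≡⟨ coeff-+ p′ q′ i ⟨
  coeff (p′ + q′) i           ∎
  where open ≡-Reasoning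

+-congˡ : ∀ p {q q′} → q ≋ q′ → p + q ≋ p + q′
+-congˡ p = +-cong ≋-refl

+-congʳ : ∀ {p p′} q → p ≋ p′ → p + q ≋ p′ + q
+-congʳ q e = +-cong e ≋-refl

+-comm : ∀ p q → p + q ≋ q + p
+-comm p q = ≋-ext λ i → begin
  coeff (p + q) i           ≡⟨ coeff-+ p q i ⟩
  coeff p i xor coeff q i   ≡⟨ xor-comm (coeff p i) (coeff q i) ⟩
  coeff q i xor coeff p i   ≡⟨ coeff-+ q p i ⟨
  coeff (q + p) i           ∎
  where open ≡-Reasoning

+-assoc : ∀ p q r → (p + q) + r ≋ p + (q + r)
+-assoc p q r = ≋-ext λ i → begin
  coeff ((p + q) + r) i                       ≡⟨ coeff-+ (p + q) r i ⟩
  coeff (p + q) i xor coeff r i               ≡⟨ cong (_xor coeff r i) (coeff-+ p q i) ⟩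
  (coeff p i xor coeff q i) xor coeff r i     ≡⟨ xor-assoc (coeff p i) (coeff q i) (coeff r i) ⟩
  coeff p i xor (coeff q i xor coeff r i)     ≡⟨ cong (coeff p i xor_) (coeff-+ q r i) ⟨
  coeff p i xor coeff (q + r) i               ≡⟨ coeff-+ p (q + r) i ⟨
  coeff (p + (q + r)) i                       ∎
  where open ≡-Reasoning

+-identityʳ : ∀ p → p + [] ≋ p
+-identityʳ p = ≋-ext λ i → trans (coeff-+ p [] i) (xor-identityʳ (coeff p i))

+-self : ∀ p → p + p ≋ []
+-self p = ≋-ext λ i → trans (coeff-+ p p i) (xor-same (coeff p i))

+-commutativeSemigroup : CommutativeSemigroup _ _
+-commutativeSemigroup = record
  { _≈_ = _≋_
  ; _∙_ = _+_
  ; isCommutativeSemigroup = record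
    { isSemigroup = record
      { isMagma = record { isEquivalence = ≋-isEquivalence ; ∙-cong = +-cong }
      ; assoc   = +-assoc
      }
    ; comm = +-comm
    }
  }

open import Algebra.Properties.CommutativeSemigroup +-commutativeSemigroup public
  using () renaming (interchange to +-interchange)

+-cancel-middle : ∀ p q r → (p + q) + (q + r) ≋ p + r
+-cancel-middle p q r = begin
  (p + q) + (q + r)   ≈⟨ +-assoc p q (q + r) ⟩
  p + (q + (q + r))   ≈⟨ +-congˡ p (+-assoc q q r) ⟨
  p + ((q + q) + r)   ≈⟨ +-congˡ p (+-congʳ r (+-self q)) ⟩
  p + r               ∎
  where open ≈-Reasoning ≋-setoid

+-swap : ∀ {x y z} → x + y ≋ z → x + z ≋ y
+-swap {x} {y} {z} e = begin
  x + z         ≈⟨ +-congˡ x e ⟨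
  x + (x + y)   ≈⟨ +-assoc x x y ⟨
  (x + x) + y   ≈⟨ +-congʳ y (+-self x) ⟩
  y             ∎
  where open ≈-Reasoning ≋-setoid

scale : Bool → Poly → Poly
scale a q = if a then q else []

∷-cong : ∀ a {p q} → p ≋ q → a ∷ p ≋ a ∷ q
∷-cong a e = ≋-ext λ { zero → refl ; (suc i) → ≋-coeff e i }

false∷[]≋[] : false ∷ [] ≋ []
false∷[]≋[] = ≈⇒≋ refl

cons-* : ∀ a r q → cons a r * q ≋ (a ∷ r) * q
cons-* true  []      q = ≋-refl
cons-* false []      q = ≋-sym false∷[]≋[]
cons-* a     (_ ∷ _) q = ≋-refl

*-norm : ∀ p q → norm p * q ≋ p * q
*-norm []      q = ≋-refl
*-norm (a ∷ p) q rewrite norm-∷ a p =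
  ≋-trans (cons-* a (norm p) q) (+-congˡ (scale a q) (∷-cong false (*-norm p q)))

*-congʳ : ∀ {p p′} q → p ≋ p′ → p * q ≋ p′ * q
*-congʳ {p} {p′} q (≈⇒≋ e) = begin
  p * q         ≈⟨ *-norm p q ⟨
  norm p * q    ≡⟨ cong (_* q) e ⟩
  norm p′ * q   ≈⟨ *-norm p′ q ⟩
  p′ * q        ∎
  where open ≈-Reasoning ≋-setoid

*-congˡ : ∀ p {q q′} → q ≋ q′ → p * q ≋ p * q′
*-congˡ []          e = ≋-refl
*-congˡ (true ∷ p)  e = +-cong e (∷-cong false (*-congˡ p e))
*-congˡ (false ∷ p) e = +-congˡ [] (∷-cong false (*-congˡ p e))

*-cong : ∀ {p p′ q q′} → p ≋ p′ → q ≋ q′ → p * q ≋ p′ * q′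
*-cong {p′ = p′} {q = q} e f = ≋-trans (*-congʳ q e) (*-congˡ p′ f)

*-zeroʳ : ∀ p → p * [] ≋ []
*-zeroʳ []          = ≋-refl
*-zeroʳ (true ∷ p)  = ≋-trans (∷-cong false (*-zeroʳ p)) false∷[]≋[]
*-zeroʳ (false ∷ p) = ≋-trans (∷-cong false (*-zeroʳ p)) false∷[]≋[]

*-identityˡ : ∀ p → one * p ≋ p
*-identityˡ p = ≋-trans (+-congˡ p false∷[]≋[]) (+-identityʳ p)

scale-+ : ∀ a q r → scale a (q + r) ≋ scale a q + scale a r
scale-+ true  q r = ≋-refl
scale-+ false q r = ≋-refl

scale-xor : ∀ a b q → scale (a xor b) q ≋ scale a q + scale b q
scale-xor true  true  q = ≋-sym (+-self q)
scale-xor true  false q = ≋-sym (+-identityʳ q)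
scale-xor false b     q = ≋-refl

scale-* : ∀ a q r → scale a q * r ≋ scale a (q * r)
scale-* true  q r = ≋-refl
scale-* false q r = ≋-refl

*-distribˡ-+ : ∀ p q r → p * (q + r) ≋ p * q + p * r
*-distribˡ-+ []      q r = ≋-refl
*-distribˡ-+ (a ∷ p) q r =
  ≋-trans (+-cong (scale-+ a q r) (∷-cong false (*-distribˡ-+ p q r)))
          (+-interchange (scale a q) (scale a r) (false ∷ (p * q)) (false ∷ (p * r)))

*-distribʳ-+ : ∀ p p′ q → (p + p′) * q ≋ p * q + p′ * q
*-distribʳ-+ []      p′       q = ≋-refl
*-distribʳ-+ (a ∷ p) []       q = ≋-sym (+-identityʳ _)
*-distribʳ-+ (a ∷ p) (b ∷ p′) q =
  ≋-trans (+-cong (scale-xor a b q) (∷-cong false (*-distribʳ-+ p p′ q)))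
          (+-interchange (scale a q) (scale b q) (false ∷ (p * q)) (false ∷ (p′ * q)))

*-assoc : ∀ p q r → (p * q) * r ≋ p * (q * r)
*-assoc []      q r = ≋-refl
*-assoc (a ∷ p) q r =
  ≋-trans (*-distribʳ-+ (scale a q) (false ∷ (p * q)) r)
          (+-cong (scale-* a q r) (∷-cong false (*-assoc p q r)))

*-∷ʳ : ∀ p b q → p * (b ∷ q) ≋ scale b p + (false ∷ (p * q))
*-∷ʳ []      b q = ≋-sym (≋-trans (+-congʳ (false ∷ []) (scale-[] b)) false∷[]≋[])
  where
  scale-[] : ∀ b → scale b [] ≋ []
  scale-[] true  = ≋-refl
  scale-[] false = ≋-refl
*-∷ʳ (a ∷ p) b q = begin
  scale a (b ∷ q) + (false ∷ (p * (b ∷ q)))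
    ≈⟨ +-congˡ (scale a (b ∷ q)) (∷-cong false (*-∷ʳ p b q)) ⟩
  scale a (b ∷ q) + ((false ∷ scale b p) + (false ∷ false ∷ (p * q)))
    ≈⟨ +-assoc (scale a (b ∷ q)) (false ∷ scale b p) (false ∷ false ∷ (p * q)) ⟨
  (scale a (b ∷ q) + (false ∷ scale b p)) + (false ∷ false ∷ (p * q))
    ≈⟨ +-congʳ (false ∷ false ∷ (p * q)) (cross a b) ⟩
  (scale b (a ∷ p) + (false ∷ scale a q)) + (false ∷ false ∷ (p * q))
    ≈⟨ +-assoc (scale b (a ∷ p)) (false ∷ scale a q) (false ∷ false ∷ (p * q)) ⟩
  scale b (a ∷ p) + (false ∷ (scale a q + (false ∷ (p * q))))
    ∎
  where
  open ≈-Reasoning ≋-setoid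
  cross : ∀ a b → scale a (b ∷ q) + (false ∷ scale b p) ≋ scale b (a ∷ p) + (false ∷ scale a q)
  cross true  true  = ∷-cong true (+-comm q p)
  cross true  false = ∷-cong false (+-identityʳ q)
  cross false true  = ∷-cong false (≋-sym (+-identityʳ p))
  cross false false = ≋-refl

*-comm : ∀ p q → p * q ≋ q * p
*-comm []      q = ≋-sym (*-zeroʳ q)
*-comm (a ∷ p) q = ≋-trans (+-congˡ (scale a q) (∷-cong false (*-comm p q))) (≋-sym (*-∷ʳ q a p))

*-identityʳ : ∀ p → p * one ≋ p
*-identityʳ p = ≋-trans (*-comm p one) (*-identityˡ p)

size-cong : ∀ {p q} → p ≋ q → size p ≡ size q
size-cong (≈⇒≋ e) = cong length e

coeff-≥size : ∀ p {i} → size p ≤ i → coeff p i ≡ false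
coeff-≥size p {i} le = trans (sym (coeff-norm p i)) (beyond (norm p) le)
  where
  beyond : ∀ l {i} → length l ≤ i → coeff l i ≡ false
  beyond []      le        = refl
  beyond (a ∷ l) (s≤s le)  = beyond l le

coeff-top : ∀ p {n} → size p ≡ suc n → coeff p n ≡ true
coeff-top p {n} e = trans (sym (coeff-norm p n)) (top p e)
  where
  top-cons : ∀ a l {n} → (∀ {m} → length l ≡ suc m → coeff l m ≡ true)
           → length (cons a l) ≡ suc n → coeff (cons a l) n ≡ true
  top-cons true  []      {zero} ih e = refl
  top-cons a     (_ ∷ l) {suc n} ih e = ih (ℕ.suc-injective e)
  top-cons true  []      {suc n} ih ()
  top-cons false []      ih ()
  top-cons a     (_ ∷ l) {zero} ih ()
  top : ∀ p {n} → length (norm p) ≡ suc n → coeff (norm p) n ≡ true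
  top []      ()
  top (a ∷ p) e rewrite norm-∷ a p = top-cons a (norm p) (top p) e

coeff≡true⇒<size : ∀ p {i} → coeff p i ≡ true → i < size p
coeff≡true⇒<size p {i} c with i <? size p
... | yes lt = lt
... | no  ge with trans (sym c) (coeff-≥size p (ℕ.≮⇒≥ ge))
...   | ()

size-≤-vanishing : ∀ p {n} → (∀ {i} → n ≤ i → coeff p i ≡ false) → size p ≤ n
size-≤-vanishing p {n} vanish with size p in e
... | zero  = z≤n
... | suc m with n ≤? m
...   | no  gt = ℕ.≰⇒> gt
...   | yes le with trans (sym (coeff-top p e)) (vanish le)
...     | ()

size≡0⇒≋[] : ∀ {p} → size p ≡ 0 → p ≋ []
size≡0⇒≋[] {p} e with norm p in eq
... | []    = ≈⇒≋ eq

size-+ : ∀ p q → size p < size q → size (p + q) ≡ size q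
size-+ p q lt with size q in eq
... | suc m = ℕ.≤-antisym upper lower
  where
  upper : size (p + q) ≤ suc m
  upper = size-≤-vanishing (p + q) λ {i} le → begin
    coeff (p + q) i          ≡⟨ coeff-+ p q i ⟩
    coeff p i xor coeff q i  ≡⟨ cong₂ _xor_ (coeff-≥size p (ℕ.≤-trans (ℕ.<⇒≤ lt) le))
                                              (coeff-≥size q (subst (_≤ i) (sym eq) le)) ⟩
    false                    ∎
    where open ≡-Reasoning
  lower : suc m ≤ size (p + q)
  lower = coeff≡true⇒<size (p + q) (begin
    coeff (p + q) m          ≡⟨ coeff-+ p q m ⟩
    coeff p m xor coeff q m  ≡⟨ cong₂ _xor_ (coeff-≥size p (ℕ.≤-pred lt)) (coeff-top q eq) ⟩
    true                     ∎)
    where open ≡-Reasoning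

size-∷ : ∀ a p {k} → size p ≡ suc k → size (a ∷ p) ≡ suc (suc k)
size-∷ a p e rewrite norm-∷ a p with norm p
... | _ ∷ _ = cong suc e

size-∷[] : ∀ a p → size p ≡ 0 → size (a ∷ p) ≡ (if a then 1 else 0)
size-∷[] a p e rewrite norm-∷ a p with norm p
size-∷[] true  p e | [] = refl
size-∷[] false p e | [] = refl

size-scale : ∀ a q → size (scale a q) ≤ size q
size-scale true  q = ℕ.≤-refl
size-scale false q = z≤n

size-* : ∀ p q {k m} → size p ≡ suc k → size q ≡ suc m → size (p * q) ≡ suc (k ℕ.+ m)
size-* (a ∷ p) q {k} {m} sp sq with size p in e
... | zero with a | trans (sym (size-∷[] a p e)) sp
...   | true | refl = begin
  size (q + (false ∷ (p * q)))   ≡⟨ size-cong (+-congˡ q p*q≋[]) ⟩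
  size (q + [])                  ≡⟨ size-cong (+-identityʳ q) ⟩
  size q                         ≡⟨ sq ⟩
  suc m                          ∎
  where
  open ≡-Reasoning
  p*q≋[] : false ∷ (p * q) ≋ []
  p*q≋[] = ≋-trans (∷-cong false (*-congʳ q (size≡0⇒≋[] {p} e))) false∷[]≋[]
size-* (a ∷ p) q {k} {m} sp sq | suc k′ with trans (sym (size-∷ a p e)) sp
... | refl = trans (size-+ (scale a q) (false ∷ (p * q)) lt) shifted
  where
  shifted : size (false ∷ (p * q)) ≡ suc (suc (k′ ℕ.+ m))
  shifted = size-∷ false (p * q) (size-* p q e sq)
  lt : size (scale a q) < size (false ∷ (p * q))
  lt = ℕ.≤-<-trans (size-scale a q)
         (subst₂ _<_ (sym sq) (sym shifted) (s≤s (s≤s (ℕ.m≤n+m m k′))))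

degree : Poly → ℕ
degree p = size p ∸ 1

-- Long division by B of degree d, reading the dividend from its top coefficient down.
divStep : ℕ → Poly → Bool → Poly × Poly → Poly × Poly
divStep d B a (q , r) =
  if coeff (a ∷ r) d then (true ∷ q , (a ∷ r) + B) else (false ∷ q , a ∷ r)

divModBy : ℕ → Poly → Poly → Poly × Poly
divModBy d B []      = [] , []
divModBy d B (a ∷ A) = divStep d B a (divModBy d B A)

quot rem : Poly → Poly → Poly
quot A B = proj₁ (divModBy (degree B) B A)
rem  A B = proj₂ (divModBy (degree B) B A)

divModBy-correct : ∀ d B A → A ≋ proj₁ (divModBy d B A) * B + proj₂ (divModBy d B A)
divModBy-correct d B []      = ≋-refl
divModBy-correct d B (a ∷ A) = step (divModBy-correct d B A)
  where
  q = proj₁ (divModBy d B A)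
  r = proj₂ (divModBy d B A)
  step : A ≋ q * B + r → a ∷ A ≋ proj₁ (divStep d B a (q , r)) * B + proj₂ (divStep d B a (q , r))
  step e with coeff (a ∷ r) d
  ... | false = ∷-cong a e
  ... | true  = ≋-trans (∷-cong a e) (≋-sym (begin
    (B + (false ∷ (q * B))) + ((a ∷ r) + B)   ≈⟨ +-congˡ (B + (false ∷ (q * B))) (+-comm (a ∷ r) B) ⟩
    (B + (false ∷ (q * B))) + (B + (a ∷ r))   ≈⟨ +-interchange B (false ∷ (q * B)) B (a ∷ r) ⟩
    (B + B) + ((false ∷ (q * B)) + (a ∷ r))   ≈⟨ +-congʳ _ (+-self B) ⟩
    (false ∷ (q * B)) + (a ∷ r)               ∎))
    where open ≈-Reasoning ≋-setoid

divMod-correct : ∀ A B → A ≋ quot A B * B + rem A B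
divMod-correct A B = divModBy-correct (degree B) B A

size-≤-from : ∀ x {d} → coeff x d ≡ false → (∀ {j} → d ≤ j → coeff x (suc j) ≡ false) → size x ≤ d
size-≤-from x at above = size-≤-vanishing x vanish
  where
  vanish : ∀ {i} → _ ≤ i → coeff x i ≡ false
  vanish le with ℕ.m≤n⇒m<n∨m≡n le
  ... | inj₂ refl      = at
  ... | inj₁ (s≤s le′) = above le′

coeff-≥pred-size : ∀ x {n d} → n ≡ suc d → size x < n → ∀ {j} → d ≤ j → coeff x j ≡ false
coeff-≥pred-size x refl lt le = coeff-≥size x (ℕ.≤-trans (ℕ.≤-pred lt) le)

remBy-small : ∀ A B {d} → size B ≡ suc d → size (proj₂ (divModBy d B A)) < size B
remBy-small []      B e = subst (0 <_) (sym e) (s≤s z≤n)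
remBy-small (a ∷ A) B {d} e with coeff (a ∷ proj₂ (divModBy d B A)) d in top
... | false = subst (size (a ∷ r) <_) (sym e)
                (s≤s (size-≤-from (a ∷ r) top (coeff-≥pred-size r e (remBy-small A B e))))
  where r = proj₂ (divModBy d B A)
... | true = subst (size ((a ∷ r) + B) <_) (sym e) (s≤s (size-≤-from ((a ∷ r) + B)
                (trans (coeff-+ (a ∷ r) B d) (cong₂ _xor_ top (coeff-top B e)))
                λ {j} le → trans (coeff-+ (a ∷ r) B (suc j))
                  (cong₂ _xor_ (coeff-≥pred-size r e (remBy-small A B e) le)
                               (coeff-≥size B (subst (_≤ suc j) (sym e) (s≤s le))))))
  where r = proj₂ (divModBy d B A)

rem-small : ∀ A B {d} → size B ≡ suc d → size (rem A B) < size B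
rem-small A B e =
  subst (λ k → size (proj₂ (divModBy k B A)) < size B) (sym (cong (_∸ 1) e)) (remBy-small A B e)

infix 4 _∣ₚ_
_∣ₚ_ : Poly → Poly → Set
P ∣ₚ A = Σ Poly λ C → C * P ≋ A

∣ₚ⇒∣ : ∀ {P A} → P ∣ₚ A → P ∣ A
∣ₚ⇒∣ (C , e) = C , ≋⇒≈ e

∣⇒∣ₚ : ∀ {P A} → P ∣ A → P ∣ₚ A
∣⇒∣ₚ (C , e) = C , ≈⇒≋ e

∣ₚ-refl : ∀ P → P ∣ₚ P
∣ₚ-refl P = one , *-identityˡ P

∣ₚ-trans : ∀ {P A B} → P ∣ₚ A → A ∣ₚ B → P ∣ₚ B
∣ₚ-trans {P} (C , e) (D , f) = D * C , ≋-trans (*-assoc D C P) (≋-trans (*-congˡ D e) f)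

∣ₚ-respʳ : ∀ {P A B} → A ≋ B → P ∣ₚ A → P ∣ₚ B
∣ₚ-respʳ e (C , f) = C , ≋-trans f e

∣ₚ-respˡ : ∀ {P Q A} → P ≋ Q → P ∣ₚ A → Q ∣ₚ A
∣ₚ-respˡ e (C , f) = C , ≋-trans (*-congˡ C (≋-sym e)) f

∣ₚ-*ˡ : ∀ {P A} B → P ∣ₚ A → P ∣ₚ B * A
∣ₚ-*ˡ {P} B (C , e) = B * C , ≋-trans (*-assoc B C P) (*-congˡ B e)

∣ₚ-+ : ∀ {P A B} → P ∣ₚ A → P ∣ₚ B → P ∣ₚ A + B
∣ₚ-+ {P} (C , e) (D , f) = C + D , ≋-trans (*-distribʳ-+ C D P) (+-cong e f)

∣ₚ-size : ∀ {P A m} → size P ≡ suc m → P ∣ₚ A → size A ≡ 0 ⊎ suc m ≤ size A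
∣ₚ-size {P} {A} {m} sP (C , e) with size C in sC
... | zero  = inj₁ (trans (sym (size-cong e)) (size-cong (*-congʳ P (size≡0⇒≋[] {C} sC))))
... | suc k = inj₂ (subst (suc m ≤_) (trans (sym (size-* C P sC sP)) (size-cong e)) (s≤s (ℕ.m≤n+m m k)))

rem≋[]⇒∣ₚ : ∀ A B → rem A B ≋ [] → B ∣ₚ A
rem≋[]⇒∣ₚ A B e = quot A B , ≋-sym (≋-trans (divMod-correct A B) (≋-trans (+-congˡ _ e) (+-identityʳ _)))

∣ₚ-rem : ∀ {A B} → B ∣ₚ A → B ∣ₚ rem A B
∣ₚ-rem {A} {B} (C , e) = C + quot A B , (begin
  (C + quot A B) * B         ≈⟨ *-distribʳ-+ C (quot A B) B ⟩
  C * B + quot A B * B       ≈⟨ +-congʳ _ e ⟩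
  A + quot A B * B           ≈⟨ +-comm A _ ⟩
  quot A B * B + A           ≈⟨ +-swap (≋-sym (divMod-correct A B)) ⟩
  rem A B                    ∎)
  where open ≈-Reasoning ≋-setoid

∣ₚ⇒rem≋[] : ∀ A B {d} → size B ≡ suc d → B ∣ₚ A → rem A B ≋ []
∣ₚ⇒rem≋[] A B sB B∣A with ∣ₚ-size sB (∣ₚ-rem B∣A)
... | inj₁ z  = size≡0⇒≋[] {rem A B} z
... | inj₂ le = ⊥-elim (ℕ.<⇒≱ (rem-small A B sB) (subst (_≤ size (rem A B)) (sym sB) le))

rem≋[]⇒quot∣ₚ : ∀ A B → rem A B ≋ [] → quot A B ∣ₚ A
rem≋[]⇒quot∣ₚ A B r≋0 = B , ≋-trans (*-comm B (quot A B)) (proj₂ (rem≋[]⇒∣ₚ A B r≋0))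

¬∣ₚone : ∀ {P m} → size P ≡ suc (suc m) → ¬ P ∣ₚ one
¬∣ₚone sP d with ∣ₚ-size sP d
... | inj₂ (s≤s ())

-- Congruences, powers and σ

infix 4 _≡_[mod_]
record _≡_[mod_] (A B P : Poly) : Set where
  constructor mod
  field ∣-difference : P ∣ₚ A + B
open _≡_[mod_] public

≋⇒≡-mod : ∀ {A B P} → A ≋ B → A ≡ B [mod P ]
≋⇒≡-mod {A} {B} e = mod ([] , ≋-sym (≋-trans (+-congʳ B e) (+-self B)))

≡-mod-refl : ∀ {A P} → A ≡ A [mod P ]
≡-mod-refl = ≋⇒≡-mod ≋-refl

≡-mod-sym : ∀ {A B P} → A ≡ B [mod P ] → B ≡ A [mod P ]
≡-mod-sym {A} {B} (mod d) = mod (∣ₚ-respʳ (+-comm A B) d)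

≡-mod-trans : ∀ {A B C P} → A ≡ B [mod P ] → B ≡ C [mod P ] → A ≡ C [mod P ]
≡-mod-trans {A} {B} {C} (mod d) (mod d′) = mod (∣ₚ-respʳ (+-cancel-middle A B C) (∣ₚ-+ d d′))

≡-mod-+ : ∀ {A A′ B B′ P} → A ≡ A′ [mod P ] → B ≡ B′ [mod P ] → A + B ≡ A′ + B′ [mod P ]
≡-mod-+ {A} {A′} {B} {B′} (mod d) (mod d′) = mod (∣ₚ-respʳ (+-interchange A A′ B B′) (∣ₚ-+ d d′))

≡-mod-* : ∀ {A A′ B B′ P} → A ≡ A′ [mod P ] → B ≡ B′ [mod P ] → A * B ≡ A′ * B′ [mod P ]
≡-mod-* {A} {A′} {B} {B′} (mod d) (mod d′) = mod (∣ₚ-respʳ expand (∣ₚ-+ (∣ₚ-*ˡ A d′) (∣ₚ-*ˡ B′ d)))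
  where
  expand : A * (B + B′) + B′ * (A + A′) ≋ A * B + A′ * B′
  expand = begin
    A * (B + B′) + B′ * (A + A′)             ≈⟨ +-cong (*-distribˡ-+ A B B′) (*-distribˡ-+ B′ A A′) ⟩
    (A * B + A * B′) + (B′ * A + B′ * A′)    ≈⟨ +-congˡ (A * B + A * B′) (+-cong (*-comm B′ A) (*-comm B′ A′)) ⟩
    (A * B + A * B′) + (A * B′ + A′ * B′)    ≈⟨ +-cancel-middle (A * B) (A * B′) (A′ * B′) ⟩
    A * B + A′ * B′                          ∎
    where open ≈-Reasoning ≋-setoid

≡-mod-setoid : Poly → Setoid _ _
≡-mod-setoid P = record
  { Carrier       = Poly
  ; _≈_           = λ A B → A ≡ B [mod P ]
  ; isEquivalence = record { refl = ≡-mod-refl ; sym = ≡-mod-sym ; trans = ≡-mod-trans }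
  }

∣ₚ⇒≡0 : ∀ {P A} → P ∣ₚ A → A ≡ [] [mod P ]
∣ₚ⇒≡0 {A = A} d = mod (∣ₚ-respʳ (≋-sym (+-identityʳ A)) d)

≡0⇒∣ₚ : ∀ {P A} → A ≡ [] [mod P ] → P ∣ₚ A
≡0⇒∣ₚ {A = A} (mod d) = ∣ₚ-respʳ (+-identityʳ A) d

≡-mod-rem : ∀ A P → A ≡ rem A P [mod P ]
≡-mod-rem A P = mod (quot A P , ≋-sym (≋-trans (+-comm A (rem A P))
  (+-swap (≋-trans (+-comm (rem A P) (quot A P * P)) (≋-sym (divMod-correct A P))))))

one≢0-mod : ∀ {P} → 2 ≤ size P → ¬ one ≡ [] [mod P ]
one≢0-mod {P} two one≡0 with size P in sP
one≢0-mod {P} (s≤s (s≤s _)) one≡0 | suc (suc m) = ¬∣ₚone sP (≡0⇒∣ₚ one≡0)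

^-cong : ∀ {A B} n → A ≋ B → A ^ n ≋ B ^ n
^-cong zero    e = ≋-refl
^-cong (suc n) e = *-cong e (^-cong n e)

≡-mod-^ : ∀ {A B P} n → A ≡ B [mod P ] → A ^ n ≡ B ^ n [mod P ]
≡-mod-^ zero    e = ≡-mod-refl
≡-mod-^ (suc n) e = ≡-mod-* e (≡-mod-^ n e)

^-+ : ∀ A m n → A ^ (m ℕ.+ n) ≋ A ^ m * A ^ n
^-+ A zero    n = ≋-sym (*-identityˡ _)
^-+ A (suc m) n = ≋-trans (*-congˡ A (^-+ A m n)) (≋-sym (*-assoc A (A ^ m) (A ^ n)))

^-* : ∀ A m n → A ^ (m ℕ.* n) ≋ (A ^ n) ^ m
^-* A zero    n = ≋-refl
^-* A (suc m) n = ≋-trans (^-+ A n (m ℕ.* n)) (*-congˡ (A ^ n) (^-* A m n))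

one-^ : ∀ n → one ^ n ≋ one
one-^ zero    = ≋-refl
one-^ (suc n) = ≋-trans (*-identityˡ _) (one-^ n)

σ-cong : ∀ {M M′} n → M ≋ M′ → sigmaPow M n ≋ sigmaPow M′ n
σ-cong zero    e = ≋-refl
σ-cong (suc n) e = +-cong (σ-cong n e) (^-cong (suc n) e)

≡-mod-σ : ∀ {M M′ P} n → M ≡ M′ [mod P ] → sigmaPow M n ≡ sigmaPow M′ n [mod P ]
≡-mod-σ zero    e = ≡-mod-refl
≡-mod-σ (suc n) e = ≡-mod-+ (≡-mod-σ n e) (≡-mod-^ (suc n) e)

σ-split : ∀ M m k → sigmaPow M (m ℕ.+ suc k) ≋ sigmaPow M m + M ^ suc m * sigmaPow M k
σ-split M m zero rewrite ℕ.+-comm m 1 = +-congˡ (sigmaPow M m) (≋-sym (*-identityʳ _))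
σ-split M m (suc k) rewrite ℕ.+-suc m (suc k) = begin
  sigmaPow M (m ℕ.+ suc k) + M ^ suc (m ℕ.+ suc k)
    ≈⟨ +-congʳ _ (σ-split M m k) ⟩
  (sigmaPow M m + M ^ suc m * sigmaPow M k) + M ^ suc (m ℕ.+ suc k)
    ≈⟨ +-assoc (sigmaPow M m) _ _ ⟩
  sigmaPow M m + (M ^ suc m * sigmaPow M k + M ^ (suc m ℕ.+ suc k))
    ≈⟨ +-congˡ (sigmaPow M m) (+-congˡ _ (^-+ M (suc m) (suc k))) ⟩
  sigmaPow M m + (M ^ suc m * sigmaPow M k + M ^ suc m * M ^ suc k)
    ≈⟨ +-congˡ (sigmaPow M m) (*-distribˡ-+ (M ^ suc m) _ _) ⟨
  sigmaPow M m + M ^ suc m * (sigmaPow M k + M ^ suc k)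
    ∎
  where open ≈-Reasoning ≋-setoid

σ-factor : ∀ M a b → sigmaPow M (b ℕ.* suc a ℕ.+ a) ≋ sigmaPow (M ^ suc a) b * sigmaPow M a
σ-factor M a zero    = ≋-sym (*-identityˡ _)
σ-factor M a (suc b) = begin
  sigmaPow M (suc b ℕ.* suc a ℕ.+ a)
    ≡⟨ cong (sigmaPow M) split ⟨
  sigmaPow M (n ℕ.+ suc a)
    ≈⟨ σ-split M n a ⟩
  sigmaPow M n + M ^ suc n * sigmaPow M a
    ≈⟨ +-cong (σ-factor M a b) (*-congʳ (sigmaPow M a) (≋-trans (≋-reflexive (cong (M ^_) top)) (^-* M (suc b) (suc a)))) ⟩
  sigmaPow (M ^ suc a) b * sigmaPow M a + (M ^ suc a) ^ suc b * sigmaPow M a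
    ≈⟨ *-distribʳ-+ (sigmaPow (M ^ suc a) b) _ (sigmaPow M a) ⟨
  sigmaPow (M ^ suc a) (suc b) * sigmaPow M a
    ∎
  where
  open ≈-Reasoning ≋-setoid
  n = b ℕ.* suc a ℕ.+ a
  split : (b ℕ.* suc a ℕ.+ a) ℕ.+ suc a ≡ suc b ℕ.* suc a ℕ.+ a
  split = solve (a ∷ b ∷ [])
  top : suc (b ℕ.* suc a ℕ.+ a) ≡ suc b ℕ.* suc a
  top = solve (a ∷ b ∷ [])

σ-telescope : ∀ M n → (M + one) * sigmaPow M n ≋ M ^ suc n + one
σ-telescope M zero    = ≋-trans (*-identityʳ _) (+-congʳ one (≋-sym (*-identityʳ M)))
σ-telescope M (suc n) = begin
  (M + one) * (sigmaPow M n + M ^ suc n)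
    ≈⟨ *-distribˡ-+ (M + one) (sigmaPow M n) (M ^ suc n) ⟩
  (M + one) * sigmaPow M n + (M + one) * M ^ suc n
    ≈⟨ +-cong (σ-telescope M n) (*-distribʳ-+ M one (M ^ suc n)) ⟩
  (M ^ suc n + one) + (M ^ suc (suc n) + one * M ^ suc n)
    ≈⟨ +-congˡ (M ^ suc n + one) (+-congˡ (M ^ suc (suc n)) (*-identityˡ (M ^ suc n))) ⟩
  (M ^ suc n + one) + (M ^ suc (suc n) + M ^ suc n)
    ≈⟨ +-congˡ (M ^ suc n + one) (+-comm (M ^ suc (suc n)) (M ^ suc n)) ⟩
  (M ^ suc n + one) + (M ^ suc n + M ^ suc (suc n))
    ≈⟨ +-cong (+-comm (M ^ suc n) one) ≋-refl ⟩
  (one + M ^ suc n) + (M ^ suc n + M ^ suc (suc n))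
    ≈⟨ +-cancel-middle one (M ^ suc n) (M ^ suc (suc n)) ⟩
  one + M ^ suc (suc n)
    ≈⟨ +-comm one (M ^ suc (suc n)) ⟩
  M ^ suc (suc n) + one
    ∎
  where open ≈-Reasoning ≋-setoid

σ-one-even : ∀ k → sigmaPow one (k ℕ.* 2) ≋ one
σ-one-even zero    = ≋-refl
σ-one-even (suc k) = begin
  (sigmaPow one (k ℕ.* 2) + one ^ suc (k ℕ.* 2)) + one ^ suc (suc (k ℕ.* 2))
    ≈⟨ +-cong (+-cong (σ-one-even k) (one-^ (suc (k ℕ.* 2)))) (one-^ (suc (suc (k ℕ.* 2)))) ⟩
  (one + one) + one
    ≈⟨ +-congʳ one (+-self one) ⟩
  one
    ∎
  where open ≈-Reasoning ≋-setoid

σ-∣ₚ : ∀ M {a n} → suc a ∣ℕ suc n → sigmaPow M a ∣ₚ sigmaPow M n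
σ-∣ₚ M {a} {n} (divides (suc b) eq) =
  sigmaPow (M ^ suc a) b , ≋-sym (≋-trans (≋-reflexive (cong (sigmaPow M) n≡)) (σ-factor M a b))
  where
  n≡ : n ≡ b ℕ.* suc a ℕ.+ a
  n≡ = trans (ℕ.suc-injective eq) (ℕ.+-comm a (b ℕ.* suc a))

size-^ : ∀ M {d} n → size M ≡ suc (suc d) → size (M ^ n) ≡ suc (n ℕ.* suc d)
size-^ M zero    sM = refl
size-^ M (suc n) sM = size-* M (M ^ n) sM (size-^ M n sM)

size-σ : ∀ M {d} n → size M ≡ suc (suc d) → size (sigmaPow M n) ≡ suc (n ℕ.* suc d)
size-σ M zero    sM = refl
size-σ M {d} (suc n) sM = trans (size-+ (sigmaPow M n) (M ^ suc n) lt) (size-^ M (suc n) sM)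
  where
  lt : size (sigmaPow M n) < size (M ^ suc n)
  lt rewrite size-σ M n sM | size-^ M (suc n) sM = s≤s (s≤s (ℕ.m≤n+m (n ℕ.* suc d) d))

-- σ(M^n) in Horner form, which evaluates with n multiplications instead of n²/2.
sigmaHorner : Poly → ℕ → Poly
sigmaHorner M zero    = one
sigmaHorner M (suc n) = one + M * sigmaHorner M n

sigmaHorner≋sigmaPow : ∀ M n → sigmaHorner M n ≋ sigmaPow M n
sigmaHorner≋sigmaPow M zero    = ≋-refl
sigmaHorner≋sigmaPow M (suc n) = begin
  one + M * sigmaHorner M n       ≈⟨ +-congˡ one (*-congˡ M (sigmaHorner≋sigmaPow M n)) ⟩
  one + M * sigmaPow M n          ≈⟨ +-congˡ one (*-congʳ (sigmaPow M n) (*-identityʳ M)) ⟨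
  one + M ^ 1 * sigmaPow M n      ≈⟨ σ-split M 0 n ⟨
  sigmaPow M (suc n)              ∎
  where open ≈-Reasoning ≋-setoid

-- Irreducible factors, by exhaustive search

listsOfLength : ℕ → List Poly
listsOfLength zero    = [] ∷ []
listsOfLength (suc n) = map (true ∷_) (listsOfLength n) ++ map (false ∷_) (listsOfLength n)

shorterThan : ℕ → List Poly
shorterThan zero    = []
shorterThan (suc n) = listsOfLength n ++ shorterThan n

∈-listsOfLength : ∀ l → l ∈ listsOfLength (length l)
∈-listsOfLength []          = here refl
∈-listsOfLength (true ∷ l)  = ∈-++⁺ˡ (∈-map⁺ (true ∷_) (∈-listsOfLength l))
∈-listsOfLength (false ∷ l) = ∈-++⁺ʳ (map (true ∷_) (listsOfLength (length l))) (∈-map⁺ (false ∷_) (∈-listsOfLength l))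

∈-shorterThan : ∀ l {n} → length l < n → l ∈ shorterThan n
∈-shorterThan l {suc n} (s≤s le) with ℕ.m≤n⇒m<n∨m≡n le
... | inj₂ refl = ∈-++⁺ˡ (∈-listsOfLength l)
... | inj₁ lt   = ∈-++⁺ʳ (listsOfLength n) (∈-shorterThan l lt)

ProperFactor : Poly → Poly → Set
ProperFactor A B = 2 ≤ size B × size B < size A × norm (rem A B) ≡ []

properFactor? : ∀ A B → Dec (ProperFactor A B)
properFactor? A B = (2 ℕ.≤? size B) ×-dec (size B <? size A) ×-dec ≡-dec Bool._≟_ (norm (rem A B)) []

no-proper-factor⇒irreducible : ∀ A → 2 ≤ size A → ¬ Any (ProperFactor A) (shorterThan (size A)) → Irreducible A
no-proper-factor⇒irreducible A two none = two , splits
  where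
  A≉0 : ∀ {Z} → size Z ≡ 0 → ¬ Z ≋ A
  A≉0 sZ Z≋A with subst (2 ≤_) (trans (sym (size-cong Z≋A)) sZ) two
  ... | ()
  splits : ∀ X Y → X * Y ≈ A → size X ≡ 1 ⊎ size Y ≡ 1
  splits X Y e with size X in sX | size Y in sY
  ... | zero        | _           = ⊥-elim (A≉0 {[]} refl (≋-trans (≋-sym (*-congʳ Y (size≡0⇒≋[] {X} sX))) (≈⇒≋ e)))
  ... | suc _       | zero        = ⊥-elim (A≉0 {[]} refl (≋-trans (≋-sym (≋-trans (*-congˡ X (size≡0⇒≋[] {Y} sY)) (*-zeroʳ X))) (≈⇒≋ e)))
  ... | suc zero    | _           = inj₁ refl
  ... | suc (suc _) | suc zero    = inj₂ refl
  ... | suc (suc kx) | suc (suc ky) = ⊥-elim (none (lose (∈-shorterThan (norm X) shorter) proper))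
    where
    sA : size A ≡ suc (suc kx ℕ.+ suc ky)
    sA = trans (sym (size-cong (≈⇒≋ {X * Y} {A} e))) (size-* X Y sX sY)
    snX : size (norm X) ≡ suc (suc kx)
    snX = trans (cong length (norm-idem X)) sX
    shorter : length (norm X) < size A
    shorter = subst₂ _<_ (sym sX) (sym sA) (s≤s (s≤s (ℕ.m<m+n kx (s≤s z≤n))))
    proper : ProperFactor A (norm X)
    proper = subst (2 ≤_) (sym snX) (s≤s (s≤s z≤n))
           , subst (_< size A) (sym (cong length (norm-idem X))) shorter
           , ≋⇒≈ (∣ₚ⇒rem≋[] A (norm X) snX
               (Y , ≋-trans (*-congˡ Y (≈⇒≋ (norm-idem X))) (≋-trans (*-comm Y X) (≈⇒≋ e))))

irreducible-factor : ∀ A → 2 ≤ size A → Σ Poly λ P → Irreducible P × P ∣ₚ A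
irreducible-factor A = search (size A) A ℕ.≤-refl
  where
  search : ∀ n A → size A ≤ n → 2 ≤ size A → Σ Poly λ P → Irreducible P × P ∣ₚ A
  search zero A le two = ⊥-elim (ℕ.<⇒≱ (ℕ.<-≤-trans (s≤s z≤n) two) le)
  search (suc n) A le two with any? (properFactor? A) (shorterThan (size A))
  ... | no none  = A , no-proper-factor⇒irreducible A two none , ∣ₚ-refl A
  ... | yes some with satisfied some
  ...   | B , twoB , B<A , B∣A with search n B (ℕ.≤-pred (ℕ.≤-trans B<A le)) twoB
  ...     | P , irr , P∣B = P , irr , ∣ₚ-trans P∣B (rem≋[]⇒∣ₚ A B (≈⇒≋ B∣A))

FactorsIn-∣ₚ : ∀ {F A B} → FactorsIn F A → B ∣ₚ A → FactorsIn F B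
FactorsIn-∣ₚ fac B∣A P irr P∣B = fac P irr (∣ₚ⇒∣ (∣ₚ-trans (∣⇒∣ₚ P∣B) B∣A))

FactorsIn-≋ : ∀ {F A B} → A ≋ B → FactorsIn F A → FactorsIn F B
FactorsIn-≋ {B = B} e fac = FactorsIn-∣ₚ fac (one , ≋-trans (*-identityˡ B) (≋-sym e))

member-divisor : ∀ {F A} → FactorsIn F A → 2 ≤ size A → Any (λ Q → Q ∣ₚ A × 2 ≤ size Q) F
member-divisor {A = A} fac two with irreducible-factor A two
... | P , irr , P∣A = Any.map (λ {Q} P≈Q → ∣ₚ-respˡ (≈⇒≋ {P} {Q} P≈Q) P∣A , subst (2 ≤_) (size-cong (≈⇒≋ {P} {Q} P≈Q)) (proj₁ irr))
                              (fac P irr (∣ₚ⇒∣ P∣A))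

divideOut : ℕ → Poly → Poly → Maybe Poly
divideOut zero    F S = nothing
divideOut (suc n) F S with rem S F ≋? []
... | yes _ = divideOut n F (quot S F)
... | no  _ = just S

¬rem≋[]⇒∤ : ∀ {F R} → 0 < size F → ¬ rem R F ≋ [] → ¬ F ∣ₚ R
¬rem≋[]⇒∤ {F} {R} pos r≢0 F∣R =
  r≢0 (∣ₚ⇒rem≋[] R F (sym (ℕ.suc-pred (size F) {{ℕ.>-nonZero pos}})) F∣R)

divideOut-sound : ∀ n F S {R} → divideOut n F S ≡ just R → R ∣ₚ S × (0 < size F → ¬ F ∣ₚ R)
divideOut-sound (suc n) F S eq with rem S F ≋? []
divideOut-sound (suc n) F S refl | no r≢0 = ∣ₚ-refl S , λ pos → ¬rem≋[]⇒∤ pos r≢0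
... | yes r≋0 with divideOut-sound n F (quot S F) eq
...   | R∣quot , F∤R = ∣ₚ-trans R∣quot (rem≋[]⇒quot∣ₚ S F r≋0) , F∤R

residue : List Poly → Poly → Maybe Poly
residue []      S = just S
residue (F ∷ Fs) S = residue Fs S >>= divideOut (size S) F

residue-sound : ∀ Fs S {R} → residue Fs S ≡ just R → R ∣ₚ S × All (λ Q → 0 < size Q → ¬ Q ∣ₚ R) Fs
residue-sound []       S refl = ∣ₚ-refl S , All.[]
residue-sound (F ∷ Fs) S eq with residue Fs S in eqR
... | just R′ with divideOut-sound (size S) F R′ eq | residue-sound Fs S eqR
...   | R∣R′ , F∤R | R′∣S , Fs∤R′ = ∣ₚ-trans R∣R′ R′∣S , F∤R All.∷ All.map (λ Q∤R′ pos Q∣R → Q∤R′ pos (∣ₚ-trans Q∣R R∣R′)) Fs∤R′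

ForeignResidue : List Poly → Poly → Set
ForeignResidue Fs S = Σ Poly λ R → residue Fs S ≡ just R × 2 ≤ size R

foreignResidue? : ∀ Fs S → Dec (ForeignResidue Fs S)
foreignResidue? Fs S with residue Fs S
... | nothing = no λ ()
... | just R with 2 ℕ.≤? size R
...   | yes two = yes (R , refl , two)
...   | no  ¬two = no λ { (_ , refl , two) → ¬two two }

foreign-residue⇒¬FactorsIn : ∀ Fs S → ForeignResidue Fs S → ¬ FactorsIn Fs S
foreign-residue⇒¬FactorsIn Fs S (R , eq , two) fac with residue-sound Fs S eq
... | R∣S , coprime = All¬⇒¬Any (All.map (λ Q∤R (Q∣R , twoQ) → Q∤R (ℕ.<-≤-trans (s≤s z≤n) twoQ) Q∣R) coprime)
                                  (member-divisor (FactorsIn-∣ₚ fac R∣S) two)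

-- Multiplicative orders modulo the members of 𝓕

mersenne : ℕ → ℕ
mersenne zero    = zero
mersenne (suc d) = suc (mersenne d ℕ.+ mersenne d)

squareMod : Poly → Poly → Poly
squareMod Q y = rem (y * y) Q

powMersenneMod : Poly → Poly → ℕ → Poly
powMersenneMod Q M zero    = one
powMersenneMod Q M (suc d) = rem (M * squareMod Q (powMersenneMod Q M d)) Q

powMersenneMod-correct : ∀ Q M d → powMersenneMod Q M d ≡ M ^ mersenne d [mod Q ]
powMersenneMod-correct Q M zero    = ≡-mod-refl
powMersenneMod-correct Q M (suc d) =
  ≡-mod-trans (≡-mod-sym (≡-mod-rem _ Q))
    (≡-mod-* (≡-mod-refl {M})
      (≡-mod-trans (≡-mod-sym (≡-mod-rem _ Q))
        (≡-mod-trans (≡-mod-* ih ih) (≋⇒≡-mod (≋-sym (^-+ M (mersenne d) (mersenne d)))))))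
  where ih = powMersenneMod-correct Q M d

^≡one-multiple : ∀ {A Q} e → A ^ e ≡ one [mod Q ] → ∀ x → A ^ (x ℕ.* e) ≡ one [mod Q ]
^≡one-multiple {A} e Aᵉ≡1 x =
  ≡-mod-trans (≋⇒≡-mod (^-* A x e)) (≡-mod-trans (≡-mod-^ x Aᵉ≡1) (≋⇒≡-mod (one-^ x)))

^≡one-of-identity : ∀ {A Q a b} x y → 1 ℕ.+ y ℕ.* b ≡ x ℕ.* a
                  → A ^ a ≡ one [mod Q ] → A ^ b ≡ one [mod Q ] → A ≡ one [mod Q ]
^≡one-of-identity {A} {Q} {a} {b} x y eq Aᵃ≡1 Aᵇ≡1 = begin
  A                  ≈⟨ ≋⇒≡-mod (≋-sym (*-identityʳ A)) ⟩
  A * one            ≈⟨ ≡-mod-* (≡-mod-refl {A}) (≡-mod-sym (^≡one-multiple b Aᵇ≡1 y)) ⟩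
  A ^ (1 ℕ.+ y ℕ.* b) ≡⟨ cong (A ^_) eq ⟩
  A ^ (x ℕ.* a)       ≈⟨ ^≡one-multiple a Aᵃ≡1 x ⟩
  one                ∎
  where open ≈-Reasoning (≡-mod-setoid Q)

^≡one-coprime : ∀ {A Q a b} → Coprime a b → A ^ a ≡ one [mod Q ] → A ^ b ≡ one [mod Q ] → A ≡ one [mod Q ]
^≡one-coprime cop Aᵃ≡1 Aᵇ≡1 with coprime-Bézout cop
... | Bézout.+- x y eq = ^≡one-of-identity x y eq Aᵃ≡1 Aᵇ≡1
... | Bézout.-+ x y eq = ^≡one-of-identity y x eq Aᵇ≡1 Aᵃ≡1

criticalPrimes : List ℕ
criticalPrimes = 3 ∷ 5 ∷ 7 ∷ 13 ∷ 17 ∷ 31 ∷ 73 ∷ 127 ∷ []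

criticalPrimes-prime : All Prime criticalPrimes
criticalPrimes-prime = from-yes (all? prime? criticalPrimes)

-- Prime factorisations of 2^d − 1 for the degrees d of the members of 𝓕
mersenneFactors : ℕ → List ℕ
mersenneFactors 2  = 3 ∷ []
mersenneFactors 3  = 7 ∷ []
mersenneFactors 4  = 3 ∷ 5 ∷ []
mersenneFactors 5  = 31 ∷ []
mersenneFactors 6  = 3 ∷ 3 ∷ 7 ∷ []
mersenneFactors 7  = 127 ∷ []
mersenneFactors 8  = 3 ∷ 5 ∷ 17 ∷ []
mersenneFactors 9  = 7 ∷ 73 ∷ []
mersenneFactors 12 = 3 ∷ 3 ∷ 5 ∷ 7 ∷ 13 ∷ []
mersenneFactors _  = []

CriticallyFactored : ℕ → Set
CriticallyFactored d = product (mersenneFactors d) ≡ mersenne d × All (_∈ criticalPrimes) (mersenneFactors d)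

criticallyFactored? : ∀ d → Dec (CriticallyFactored d)
criticallyFactored? d = (product (mersenneFactors d) ℕ.≟ mersenne d) ×-dec all? (_∈? criticalPrimes) (mersenneFactors d)

Fam-criticallyFactored : All (CriticallyFactored ∘ degree) Fam
Fam-criticallyFactored = from-yes (all? (criticallyFactored? ∘ degree) Fam)

mersenne-prime-divisor : ∀ {d p} → CriticallyFactored d → Prime p → p ∣ℕ mersenne d → p ∈ criticalPrimes
mersenne-prime-divisor (prod , critical) pr p∣ =
  All.lookup critical (factorisationHasAllPrimeFactors pr (subst (_ ∣ℕ_) (sym prod) p∣)
                         (All.map (All.lookup criticalPrimes-prime) critical))

prime-∤⇒coprime : ∀ {p n} → Prime p → ¬ p ∣ℕ n → Coprime p n
prime-∤⇒coprime pr p∤n (d∣p , d∣n) with prime⇒irreducible pr d∣p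
... | inj₁ d≡1 = d≡1
... | inj₂ refl = ⊥-elim (p∤n d∣n)

-- Admissible exponents

SigmaFactors : Poly → ℕ → Set
SigmaFactors M n = FactorsIn Fam (sigmaPow M n)

SigmaFactors-∣ : ∀ {M a n} → suc a ∣ℕ suc n → SigmaFactors M n → SigmaFactors M a
SigmaFactors-∣ {M} d fac = FactorsIn-∣ₚ fac (σ-∣ₚ M d)

σ-divisor⇒^≡one : ∀ M n {Q} → Q ∣ₚ sigmaPow M n → M ^ suc n ≡ one [mod Q ]
σ-divisor⇒^≡one M n Q∣σ = mod (∣ₚ-respʳ (σ-telescope M n) (∣ₚ-*ˡ (M + one) Q∣σ))

σ-divisor⇒≢one : ∀ M k {Q} → 2 ≤ size Q → Q ∣ₚ sigmaPow M (k ℕ.* 2) → ¬ M ≡ one [mod Q ]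
σ-divisor⇒≢one M k {Q} twoQ Q∣σ M≡1 = one≢0-mod twoQ (begin
  one                       ≈⟨ ≋⇒≡-mod (≋-sym (σ-one-even k)) ⟩
  sigmaPow one (k ℕ.* 2)    ≈⟨ ≡-mod-σ (k ℕ.* 2) M≡1 ⟨
  sigmaPow M (k ℕ.* 2)      ≈⟨ ∣ₚ⇒≡0 Q∣σ ⟩
  []                        ∎)
  where open ≈-Reasoning (≡-mod-setoid Q)

FermatCondition : Poly → Poly → Set
FermatCondition M Q = rem M Q ≋ [] ⊎ powMersenneMod Q M (degree Q) ≋ one

fermatCondition? : ∀ M Q → Dec (FermatCondition M Q)
fermatCondition? M Q = rem M Q ≋? [] ⊎-dec (powMersenneMod Q M (degree Q) ≋? one)

noncritical-prime-excluded : ∀ {M d} → size M ≡ suc (suc d) → All (FermatCondition M) Fam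
                           → ∀ k → Prime (suc (k ℕ.* 2)) → suc (k ℕ.* 2) ∉ criticalPrimes
                           → ¬ SigmaFactors M (k ℕ.* 2)
noncritical-prime-excluded _ _ zero pr _ _ = ¬prime[1] pr
noncritical-prime-excluded {M} {d} sM fermat k@(suc _) pr p∉ fac =
  excluded (lookupAny (All.zip (fermat , Fam-criticallyFactored)) (member-divisor fac two))
  where
  p = suc (k ℕ.* 2)
  two : 2 ≤ size (sigmaPow M (k ℕ.* 2))
  two = subst (2 ≤_) (sym (size-σ M (k ℕ.* 2) sM)) (s≤s (s≤s z≤n))
  excluded : ∀ {Q} → (FermatCondition M Q × CriticallyFactored (degree Q))
                   × (Q ∣ₚ sigmaPow M (k ℕ.* 2) × 2 ≤ size Q) → ⊥
  excluded {Q} ((inj₁ M≡0 , _) , Q∣σ , twoQ) =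
    one≢0-mod twoQ (≡-mod-trans (≡-mod-sym (σ-divisor⇒^≡one M (k ℕ.* 2) Q∣σ))
                                (≡-mod-^ p (∣ₚ⇒≡0 (rem≋[]⇒∣ₚ M Q M≡0))))
  excluded {Q} ((inj₂ Mᴱ≋1 , factored) , Q∣σ , twoQ) =
    σ-divisor⇒≢one M k twoQ Q∣σ (^≡one-coprime coprime (σ-divisor⇒^≡one M (k ℕ.* 2) Q∣σ) Mᴱ≡1)
    where
    Mᴱ≡1 = ≡-mod-trans (≡-mod-sym (powMersenneMod-correct Q M (degree Q))) (≋⇒≡-mod Mᴱ≋1)
    coprime = prime-∤⇒coprime pr (λ p∣ → p∉ (mersenne-prime-divisor factored pr p∣))

divisor-closed-membership :
  ∀ (P : ℕ → Set) {G A : List ℕ} {m} .{{_ : ℕ.NonZero m}}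
  → (∀ {d} → d ∣ℕ m → P d)
  → (∀ {p} → Prime p → p ∣ℕ m → p ∈ G)
  → 1 ∈ A
  → (∀ {p a} → p ∈ G → a ∈ A → P (p ℕ.* a) → p ℕ.* a ∈ A)
  → m ∈ A
divisor-closed-membership P {G} {A} {m} divisors primes 1∈A closed =
  subst (_∈ A) (sym (isFactorisation factorisation))
        (product-∈ (factors factorisation) (factorsPrime factorisation) factors∣m)
  where
  factorisation = factorise m
  factors∣m = subst (_∣ℕ m) (isFactorisation factorisation) ∣-refl
  product-∈ : ∀ fs → All Prime fs → product fs ∣ℕ m → product fs ∈ A
  product-∈ []       All.[]         _  = 1∈A
  product-∈ (p ∷ fs) (pr All.∷ prs) ∣m =
    closed (primes pr (∣-trans (m∣m*n (product fs)) ∣m))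
           (product-∈ fs prs (∣-trans (n∣m*n p) ∣m))
           (divisors ∣m)

parity : ∀ n → (Σ ℕ λ k → n ≡ k ℕ.* 2) ⊎ (Σ ℕ λ k → n ≡ suc (k ℕ.* 2))
parity zero    = inj₁ (0 , refl)
parity (suc n) with parity n
... | inj₁ (k , eq) = inj₂ (k , cong suc eq)
... | inj₂ (k , eq) = inj₁ (suc k , cong suc eq)

even≢odd : ∀ a b → a ℕ.* 2 ≢ suc (b ℕ.* 2)
even≢odd zero    b       ()
even≢odd (suc a) zero    ()
even≢odd (suc a) (suc b) eq = even≢odd a b (ℕ.suc-injective (ℕ.suc-injective eq))

odd-divisor : ∀ {d n} → d ∣ℕ suc (n ℕ.* 2) → Σ ℕ λ k → d ≡ suc (k ℕ.* 2)
odd-divisor {d} {n} d∣odd with parity d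
... | inj₂ odd = odd
... | inj₁ (k , refl) with ∣-trans (divides k refl) d∣odd
...   | divides q eq = ⊥-elim (even≢odd q n (sym eq))

Excluded : Poly → ℕ → Set
Excluded M m = ForeignResidue Fam (sigmaHorner M (ℕ.pred m))

excluded? : ∀ M m → Dec (Excluded M m)
excluded? M m = foreignResidue? Fam (sigmaHorner M (ℕ.pred m))

excluded⇒¬SigmaFactors : ∀ M m → Excluded M m → ¬ SigmaFactors M (ℕ.pred m)
excluded⇒¬SigmaFactors M m ex fac =
  foreign-residue⇒¬FactorsIn Fam (sigmaHorner M (ℕ.pred m)) ex (FactorsIn-≋ (≋-sym (sigmaHorner≋sigmaPow M (ℕ.pred m))) fac)

-- Evidence, checkable by evaluation, that σ(M^{m-1}) with m odd factors in 𝓕 only if m ∈ A;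
-- G lists the admissible primes.
ExponentBound : Poly → List ℕ → List ℕ → Set
ExponentBound M G A =
    2 ≤ size M
  × All (FermatCondition M) Fam
  × All (λ p → p ∈ G ⊎ Excluded M p) criticalPrimes
  × 1 ∈ A
  × All (λ p → All (λ a → p ℕ.* a ∈ A ⊎ Excluded M (p ℕ.* a)) A) G

exponentBound? : ∀ M G A → Dec (ExponentBound M G A)
exponentBound? M G A =
      2 ℕ.≤? size M
  ×-dec all? (fermatCondition? M) Fam
  ×-dec all? (λ p → (p ∈? G) ⊎-dec excluded? M p) criticalPrimes
  ×-dec 1 ∈? A
  ×-dec all? (λ p → all? (λ a → (p ℕ.* a ∈? A) ⊎-dec excluded? M (p ℕ.* a)) A) G

size≡2+ : ∀ {p} → 2 ≤ size p → size p ≡ suc (suc (size p ∸ 2))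
size≡2+ {p} two with size p
size≡2+ (s≤s (s≤s _)) | suc (suc d) = refl

sigma-exponent-bound : ∀ {M G A} → ExponentBound M G A → ∀ h → SigmaFactors M (h ℕ.* 2) → suc (h ℕ.* 2) ∈ A
sigma-exponent-bound {M} {G} {A} (two , fermat , critical , 1∈A , closed) h fac =
  divisor-closed-membership (λ m → SigmaFactors M (ℕ.pred m)) divisors primes 1∈A closed′
  where
  divisors : ∀ {d} → d ∣ℕ suc (h ℕ.* 2) → SigmaFactors M (ℕ.pred d)
  divisors {zero}  d∣ with () ← 0∣⇒≡0 d∣
  divisors {suc a} d∣ = SigmaFactors-∣ d∣ fac
  primes : ∀ {p} → Prime p → p ∣ℕ suc (h ℕ.* 2) → p ∈ G
  primes {p} pr p∣ with odd-divisor {p} {h} p∣ | p ∈? criticalPrimes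
  ... | k , refl | no  p∉ = ⊥-elim (noncritical-prime-excluded (size≡2+ {M} two) fermat k pr p∉ (divisors p∣))
  ... | _ , refl | yes p∈ with All.lookup critical p∈
  ...   | inj₁ p∈G = p∈G
  ...   | inj₂ ex  = ⊥-elim (excluded⇒¬SigmaFactors M p ex (divisors p∣))
  closed′ : ∀ {p a} → p ∈ G → a ∈ A → SigmaFactors M (ℕ.pred (p ℕ.* a)) → p ℕ.* a ∈ A
  closed′ {p} {a} p∈G a∈A fac′ with All.lookup (All.lookup closed p∈G) a∈A
  ... | inj₁ pa∈A = pa∈A
  ... | inj₂ ex   = ⊥-elim (excluded⇒¬SigmaFactors M (p ℕ.* a) ex fac′)

odd-injective : ∀ {h k} → suc (h ℕ.* 2) ≡ suc (k ℕ.* 2) → h ≡ k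
odd-injective {h} {k} eq = ℕ.*-cancelʳ-≡ h k 2 (ℕ.suc-injective eq)

sigma-exponent-bound-≈ : ∀ {M M′ G A} h → M ≈ M′ → ExponentBound M′ G A
            → FactorsIn Fam (sigmaPow M (2 ℕ.* h)) → suc (h ℕ.* 2) ∈ A
sigma-exponent-bound-≈ {M} h M≈M′ bound fac = sigma-exponent-bound bound h (FactorsIn-≋ σ≋ fac)
  where
  σ≋ : sigmaPow M (2 ℕ.* h) ≋ sigmaPow _ (h ℕ.* 2)
  σ≋ = ≋-trans (≋-reflexive (cong (sigmaPow M) (ℕ.*-comm 2 h))) (σ-cong (h ℕ.* 2) (≈⇒≋ M≈M′))

-- Opaque, so that these proofs by evaluation are not unfolded again where they are used.
opaque
  M1-bound : ExponentBound M1 (3 ∷ 5 ∷ 7 ∷ []) (1 ∷ 3 ∷ 5 ∷ 7 ∷ 15 ∷ [])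
  M1-bound = from-yes (exponentBound? M1 (3 ∷ 5 ∷ 7 ∷ []) (1 ∷ 3 ∷ 5 ∷ 7 ∷ 15 ∷ []))

  M2-bound : ExponentBound M2 (3 ∷ []) (1 ∷ 3 ∷ [])
  M2-bound = from-yes (exponentBound? M2 (3 ∷ []) (1 ∷ 3 ∷ []))

  M3-bound : ExponentBound M3 (3 ∷ []) (1 ∷ 3 ∷ [])
  M3-bound = from-yes (exponentBound? M3 (3 ∷ []) (1 ∷ 3 ∷ []))

  others-bound : All (λ M → ExponentBound M [] (1 ∷ [])) (M4 ∷ M5 ∷ M6 ∷ M7 ∷ M8 ∷ M9 ∷ M10 ∷ M11 ∷ M12 ∷ M13 ∷ [])
  others-bound = from-yes (all? (λ M → exponentBound? M [] (1 ∷ [])) (M4 ∷ M5 ∷ M6 ∷ M7 ∷ M8 ∷ M9 ∷ M10 ∷ M11 ∷ M12 ∷ M13 ∷ []))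

odd≢1 : ∀ {h} → 1 ≤ h → suc (h ℕ.* 2) ≢ 1
odd≢1 {suc h} _ ()

admissible-exponents : ∀ M h → Any (M ≈_) Mlist → 1 ≤ h → FactorsIn Fam (sigmaPow M (2 ℕ.* h))
                     → (M ≈ M1 × (h ≡ 1 ⊎ h ≡ 2 ⊎ h ≡ 3 ⊎ h ≡ 7)) ⊎ ((M ≈ M2 ⊎ M ≈ M3) × h ≡ 1)
admissible-exponents M h (here M≈M1) h≥1 fac with sigma-exponent-bound-≈ h M≈M1 M1-bound fac
... | here e                                  = ⊥-elim (odd≢1 h≥1 e)
... | there (here e)                          = inj₁ (M≈M1 , inj₁ (odd-injective e))
... | there (there (here e))                  = inj₁ (M≈M1 , inj₂ (inj₁ (odd-injective e)))
... | there (there (there (here e)))          = inj₁ (M≈M1 , inj₂ (inj₂ (inj₁ (odd-injective e))))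
... | there (there (there (there (here e))))  = inj₁ (M≈M1 , inj₂ (inj₂ (inj₂ (odd-injective e))))
admissible-exponents M h (there (here M≈M2)) h≥1 fac with sigma-exponent-bound-≈ h M≈M2 M2-bound fac
... | here e         = ⊥-elim (odd≢1 h≥1 e)
... | there (here e) = inj₂ (inj₁ M≈M2 , odd-injective e)
admissible-exponents M h (there (there (here M≈M3))) h≥1 fac with sigma-exponent-bound-≈ h M≈M3 M3-bound fac
... | here e         = ⊥-elim (odd≢1 h≥1 e)
... | there (here e) = inj₂ (inj₂ M≈M3 , odd-injective e)
admissible-exponents M h (there (there (there M∈others))) h≥1 fac with lookupAny others-bound M∈others
... | bound , M≈M′ with sigma-exponent-bound-≈ h M≈M′ bound fac
...   | here e = ⊥-elim (odd≢1 h≥1 e)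

lemma3p26 :
    (∀ (M : Poly) (h : ℕ) → Any (M ≈_) Mlist → 1 ≤ h
      → FactorsIn Fam (sigmaPow M (2 Data.Nat.* h))
      → (M ≈ M1 × (h ≡ 1 ⊎ h ≡ 2 ⊎ h ≡ 3 ⊎ h ≡ 7))
        ⊎ ((M ≈ M2 ⊎ M ≈ M3) × h ≡ 1))
    × (sigmaPow M2 2 ≈ M1 * M5)
    × (sigmaPow M3 2 ≈ M1 * M4)
    × (sigmaPow M1 2 ≈ S1)
    × (sigmaPow M1 4 ≈ S8)
    × (sigmaPow M1 6 ≈ M2 * M3 * S2)
    × (sigmaPow M1 14 ≈ M4 * M5 * S1 * S7 * S8)
lemma3p26 = admissible-exponents
          , ≋⇒≈ (from-yes (sigmaPow M2 2 ≋? M1 * M5))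
          , ≋⇒≈ (from-yes (sigmaPow M3 2 ≋? M1 * M4))
          , ≋⇒≈ (from-yes (sigmaPow M1 2 ≋? S1))
          , ≋⇒≈ (from-yes (sigmaPow M1 4 ≋? S8))
          , ≋⇒≈ (from-yes (sigmaPow M1 6 ≋? M2 * M3 * S2))
          , ≋⇒≈ (from-yes (sigmaPow M1 14 ≋? M4 * M5 * S1 * S7 * S8))
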